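{- Let $n>2$ be an integer. For every simple undirected graph $G$ on $n$ vertices and every edge $e \notin E(G)$ between two distinct vertices of $G$, $|\Lambda(G,G+e)| \le 3f(n-2)$; moreover, for each $n>2$ there exist a graph $G$ on $n$ vertices and an edge $e\notin E(G)$ with $|\Lambda(G,G+e)| = 3f(n-2)$.
   Context: All graphs are simple and undirected. A clique is a set of pairwise adjacent vertices; it is maximal if not properly contained in another clique. $\mathcal{C}(G)$ is the set of maximal cliques of $G$. $f(k)$ denotes the maximum number of maximal cliques of a graph on $k$ vertices. $G+e$ is the graph obtained from $G$ by adding the edge $e$. $\Lambda(G_1,G_2)=(\mathcal{C}(G_2)\setminus\mathcal{C}(G_1))\cup(\mathcal{C}(G_1)\setminus\mathcal{C}(G_2))$. -}

module Defs where

open import Data.Nat using (ℕ; zero; suc; _≤_)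
open import Data.Bool using (Bool; true; false; _∨_; _∧_; T)
open import Data.Bool.Properties using (∨-comm)
open import Data.Fin using (Fin)
open import Data.Fin.Properties using (_≟_; all?)
open import Data.Fin.Subset using (Subset; _∈_; _⊆_; inside; outside)
open import Data.Fin.Subset.Properties using (_∈?_; _⊆?_; anySubset?)
open import Data.List using (List; []; _∷_; map; _++_; filter; length)
open import Data.Vec using (_∷_; [])
open import Data.Product using (Σ; ∃; _×_; _,_; proj₁; proj₂)
open import Data.Sum using (_⊎_; inj₁; inj₂)
open import Relation.Nullary using (¬_; Dec; yes; no)
open import Relation.Nullary.Decidable using (_×-dec_; _⊎-dec_; _→-dec_; ¬?; ⌊_⌋)
open import Relation.Binary.PropositionalEquality using (_≡_; _≢_; refl; sym; trans)

record Graph (n : ℕ) : Set where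
  field
    adj     : Fin n → Fin n → Bool
    adj-sym : ∀ u v → adj u v ≡ adj v u
    adj-irr : ∀ u → adj u u ≡ false
open Graph public

Adj : ∀ {n} → Graph n → Fin n → Fin n → Set
Adj G u v = T (adj G u v)

IsClique : ∀ {n} → Graph n → Subset n → Set
IsClique G S = ∀ u v → u ∈ S → v ∈ S → u ≢ v → Adj G u v

IsMaximalClique : ∀ {n} → Graph n → Subset n → Set
IsMaximalClique G S = IsClique G S × (∀ S′ → IsClique G S′ → S ⊆ S′ → S′ ⊆ S)

_+edge_ : ∀ {n} → Graph n → Σ (Fin n × Fin n) (λ p → proj₁ p ≢ proj₂ p) → Graph n
_+edge_ {n} G ((u , v) , u≢v) = record { adj = a ; adj-sym = s ; adj-irr = i }
  where
  isE : Fin n → Fin n → Bool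
  isE x y = (⌊ x ≟ u ⌋ ∧ ⌊ y ≟ v ⌋) ∨ (⌊ x ≟ v ⌋ ∧ ⌊ y ≟ u ⌋)
  a : Fin n → Fin n → Bool
  a x y = adj G x y ∨ isE x y
  isE-sym : ∀ x y → isE x y ≡ isE y x
  isE-sym x y with x ≟ u | y ≟ v | x ≟ v | y ≟ u
  ... | yes _ | yes _ | yes _ | yes _ = refl
  ... | yes _ | yes _ | yes _ | no  _ = refl
  ... | yes _ | yes _ | no  _ | yes _ = refl
  ... | yes _ | yes _ | no  _ | no  _ = refl
  ... | yes _ | no  _ | yes _ | yes _ = refl
  ... | yes _ | no  _ | yes _ | no  _ = refl
  ... | yes _ | no  _ | no  _ | yes _ = refl
  ... | yes _ | no  _ | no  _ | no  _ = refl
  ... | no  _ | yes _ | yes _ | yes _ = refl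
  ... | no  _ | yes _ | yes _ | no  _ = refl
  ... | no  _ | yes _ | no  _ | yes _ = refl
  ... | no  _ | yes _ | no  _ | no  _ = refl
  ... | no  _ | no  _ | yes _ | yes _ = refl
  ... | no  _ | no  _ | yes _ | no  _ = refl
  ... | no  _ | no  _ | no  _ | yes _ = refl
  ... | no  _ | no  _ | no  _ | no  _ = refl
  s : ∀ x y → a x y ≡ a y x
  s x y rewrite adj-sym G x y | isE-sym x y = refl
  isE-irr : ∀ x → isE x x ≡ false
  isE-irr x with x ≟ u | x ≟ v
  ... | yes p | yes q = Data.Empty.⊥-elim (u≢v (trans (sym p) q))
    where import Data.Empty
  ... | yes _ | no  _ = refl
  ... | no  _ | yes _ = refl
  ... | no  _ | no  _ = refl
  i : ∀ x → a x x ≡ false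
  i x rewrite adj-irr G x | isE-irr x = refl

isClique? : ∀ {n} (G : Graph n) (S : Subset n) → Dec (IsClique G S)
isClique? G S = all? λ u → all? λ v →
  (u ∈? S) →-dec ((v ∈? S) →-dec ((¬? (u ≟ v)) →-dec T? (adj G u v)))
  where
  T? : (b : Bool) → Dec (T b)
  T? true  = yes _
  T? false = no λ ()

isMaximalClique? : ∀ {n} (G : Graph n) (S : Subset n) → Dec (IsMaximalClique G S)
isMaximalClique? G S = isClique? G S ×-dec maxi?
  where
  open import Data.Empty using (⊥-elim)
  bad? : ∀ S′ → Dec (IsClique G S′ × (S ⊆ S′) × ¬ (S′ ⊆ S))
  bad? S′ = isClique? G S′ ×-dec ((S ⊆? S′) ×-dec ¬? (S′ ⊆? S))
  maxi? : Dec (∀ S′ → IsClique G S′ → S ⊆ S′ → S′ ⊆ S)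
  maxi? with anySubset? bad?
  ... | yes (S′ , c , le , nle) = no λ f → nle (f S′ c le)
  ... | no ¬bad = yes go
    where
    go : ∀ S′ → IsClique G S′ → S ⊆ S′ → S′ ⊆ S
    go S′ c le with S′ ⊆? S
    ... | yes p = p
    ... | no np = ⊥-elim (¬bad (S′ , c , le , np))

allSubsets : ∀ n → List (Subset n)
allSubsets zero    = [] ∷ []
allSubsets (suc n) = map (inside ∷_) (allSubsets n) ++ map (outside ∷_) (allSubsets n)

numMaxCliques : ∀ {n} → Graph n → ℕ
numMaxCliques {n} G = length (filter (isMaximalClique? G) (allSubsets n))

InΛ : ∀ {n} → Graph n → Graph n → Subset n → Set
InΛ G₁ G₂ S = (IsMaximalClique G₂ S × ¬ IsMaximalClique G₁ S)
            ⊎ (IsMaximalClique G₁ S × ¬ IsMaximalClique G₂ S)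

cardΛ : ∀ {n} → Graph n → Graph n → ℕ
cardΛ {n} G₁ G₂ = length (filter (λ S →
  (isMaximalClique? G₂ S ×-dec ¬? (isMaximalClique? G₁ S))
  ⊎-dec (isMaximalClique? G₁ S ×-dec ¬? (isMaximalClique? G₂ S))) (allSubsets n))

-- IsF k m : m = f(k), the maximum number of maximal cliques of a graph on k vertices
IsF : ℕ → ℕ → Set
IsF k m = (∃ λ (G : Graph k) → numMaxCliques G ≡ m) × (∀ (G : Graph k) → numMaxCliques G ≤ m)

-- Write K = G + uv. A maximal clique of K that is not one of G contains both u and v,
-- and a maximal clique of G that is not one of K contains exactly one of them. In each
-- of these three classes every other vertex of the clique is a common neighbour of u
-- and v, so deleting u and v maps the class injectively into the maximal cliques of the
-- common neighbourhood of u and v, padded with universal vertices to a graph on n - 2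
-- vertices. Equality holds when u and v are nonadjacent and joined to every vertex of a
-- graph H on n - 2 vertices with f(n - 2) maximal cliques: for each maximal clique C of
-- H, adding uv creates {u, v} ∪ C and destroys {u} ∪ C and {v} ∪ C.

module Submission where

open import Defs
open import Data.Nat using (ℕ; zero; suc; _<_; _≤_; _∸_; _+_; _*_; s≤s; z≤n)
open import Data.Nat.Properties using (module ≤-Reasoning; ≤-trans; +-suc; +-monoʳ-≤; +-mono-≤; n≤1+n; +-identityʳ; +-assoc)
open import Data.Bool using (Bool; true; false; T; _∨_; _∧_)
open import Data.Bool.Properties using (T-∨; T-∧; T?)
import Data.Sum
open import Data.Fin using (Fin; zero; suc; punchIn; punchOut)
open import Data.Fin.Properties using (_≟_; punchIn-injective; punchInᵢ≢i; punchIn-punchOut)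
open import Data.Fin.Subset using (Subset; _∈_; _∉_; _⊆_; _∪_; ⁅_⁆; inside; outside)
open import Data.Fin.Subset.Properties using (_∈?_; ⊆-antisym; ⊆-reflexive; p⊆p∪q; x∈p∪q⁺; x∈p∪q⁻; x∈⁅x⁆; x∈⁅y⁆⇒x≡y)
open import Data.Vec using (_∷_; []; here; there; tabulate)
open import Data.Vec.Properties using (lookup∘tabulate; []=⇒lookup; lookup⇒[]=)
open import Data.List using (List; []; _∷_; map; _++_; filter; length)
open import Data.List.Properties using (filter-++; length-++; filter-≐; filter-none; length-removeAt′)
open import Data.List.Membership.Propositional using () renaming (_∈_ to _∈ˡ_)
open import Data.List.Membership.Propositional.Properties using (∈-map⁺; ∈-map⁻; ∈-++⁺ˡ; ∈-++⁺ʳ; ∈-filter⁺; ∈-filter⁻)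
open import Data.List.Relation.Unary.Any using (here; there; index; _─_)
open import Data.List.Relation.Unary.All as All using (All)
open import Data.List.Relation.Unary.AllPairs using (_∷_; [])
open import Data.List.Relation.Unary.Unique.Propositional using (Unique)
import Data.List.Relation.Unary.Unique.Propositional.Properties as Unique
open import Data.List.Relation.Binary.Sublist.Propositional.Properties using (filter⁺; length-mono-≤)
open import Data.List.Relation.Binary.Sublist.Propositional using (⊆-refl)
open import Data.Product using (Σ; _×_; _,_; proj₁; proj₂)
open import Data.Sum using (_⊎_; inj₁; inj₂)
open import Data.Empty using (⊥; ⊥-elim)
open import Function using (id; _∘_; case_of_; _⇔_; mk⇔; Equivalence)
open import Relation.Nullary using (¬_; Dec; yes; no; does; contradiction)
open import Relation.Nullary.Decidable using (_×-dec_; _⊎-dec_; _→-dec_; ¬?; dec-true; ⌊_⌋; toWitness; fromWitness)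
open import Level using (0ℓ)
open import Relation.Unary using (Pred; Decidable)
open import Relation.Binary.PropositionalEquality using (_≡_; _≢_; refl; sym; trans; cong; cong₂; subst; module ≡-Reasoning)

private
  variable
    A B : Set
    k n : ℕ

count : {P : Pred A 0ℓ} → Decidable P → List A → ℕ
count P? xs = length (filter P? xs)

module _ {P Q : Pred A 0ℓ} (P? : Decidable P) (Q? : Decidable Q) where

  count-mono : (∀ {x} → P x → Q x) → ∀ xs → count P? xs ≤ count Q? xs
  count-mono P⇒Q xs = length-mono-≤ (filter⁺ P? Q? (λ { refl → P⇒Q }) (⊆-refl {x = xs}))

  count-⊎ : ∀ xs → count (λ x → P? x ⊎-dec Q? x) xs ≤ count P? xs + count Q? xs
  count-⊎ [] = z≤n
  count-⊎ (x ∷ xs) with P? x | Q? x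
  ... | yes _ | yes _ = s≤s (≤-trans (count-⊎ xs) (+-monoʳ-≤ (count P? xs) (n≤1+n _)))
  ... | yes _ | no  _ = s≤s (count-⊎ xs)
  ... | no  _ | yes _ = subst (suc (count (λ x → P? x ⊎-dec Q? x) xs) ≤_)
                              (sym (+-suc (count P? xs) (count Q? xs))) (s≤s (count-⊎ xs))
  ... | no  _ | no  _ = count-⊎ xs

  count-≐ : (∀ {x} → P x ⇔ Q x) → ∀ xs → count P? xs ≡ count Q? xs
  count-≐ P⇔Q xs = cong length (filter-≐ P? Q? (Equivalence.to P⇔Q , Equivalence.from P⇔Q) xs)

module _ {P : Pred A 0ℓ} (P? : Decidable P) where

  count-++ : ∀ xs ys → count P? (xs ++ ys) ≡ count P? xs + count P? ys
  count-++ xs ys = trans (cong length (filter-++ P? xs ys)) (length-++ (filter P? xs))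

  count-map : (f : B → A) → ∀ xs → count P? (map f xs) ≡ count (P? ∘ f) xs
  count-map f [] = refl
  count-map f (x ∷ xs) with P? (f x)
  ... | yes _ = cong suc (count-map f xs)
  ... | no  _ = count-map f xs

  count-none : (∀ x → ¬ P x) → ∀ xs → count P? xs ≡ 0
  count-none ¬P xs = cong length (filter-none P? (All.universal ¬P xs))

∈-─⁺ : ∀ {x y : A} {ys} (y∈ys : y ∈ˡ ys) → x ∈ˡ ys → x ≢ y → x ∈ˡ (ys ─ y∈ys)
∈-─⁺ (here refl) (here refl) x≢y = contradiction refl x≢y
∈-─⁺ (here refl) (there x∈ys) x≢y = x∈ys
∈-─⁺ (there y∈ys) (here refl) x≢y = here refl
∈-─⁺ (there y∈ys) (there x∈ys) x≢y = there (∈-─⁺ y∈ys x∈ys x≢y)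

length-≤-injection : ∀ {xs : List A} {ys : List B} (f : A → B) → Unique xs →
  (∀ {x} → x ∈ˡ xs → f x ∈ˡ ys) → (∀ {x y} → x ∈ˡ xs → y ∈ˡ xs → f x ≡ f y → x ≡ y) →
  length xs ≤ length ys
length-≤-injection {xs = []} f _ _ _ = z≤n
length-≤-injection {xs = x ∷ xs} {ys} f (x∉xs ∷ xs!) f∈ f-inj =
  subst (suc (length xs) ≤_) (sym (length-removeAt′ ys (index fx∈ys)))
    (s≤s (length-≤-injection f xs! f∈ys─fx (λ p q → f-inj (there p) (there q))))
  where
  fx∈ys = f∈ (here refl)
  f∈ys─fx : ∀ {y} → y ∈ˡ xs → f y ∈ˡ (ys ─ fx∈ys)
  f∈ys─fx y∈xs = ∈-─⁺ fx∈ys (f∈ (there y∈xs))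
    (λ fy≡fx → All.lookup x∉xs y∈xs (sym (f-inj (there y∈xs) (here refl) fy≡fx)))

allSubsets-complete : (S : Subset n) → S ∈ˡ allSubsets n
allSubsets-complete [] = here refl
allSubsets-complete {suc n} (inside ∷ S) = ∈-++⁺ˡ (∈-map⁺ (inside ∷_) (allSubsets-complete S))
allSubsets-complete {suc n} (outside ∷ S) =
  ∈-++⁺ʳ (map (inside ∷_) (allSubsets n)) (∈-map⁺ (outside ∷_) (allSubsets-complete S))

allSubsets-unique : ∀ n → Unique (allSubsets n)
allSubsets-unique zero = All.[] ∷ []
allSubsets-unique (suc n) =
  Unique.++⁺ (Unique.map⁺ ∷-injectiveʳ (allSubsets-unique n))
             (Unique.map⁺ ∷-injectiveʳ (allSubsets-unique n)) disjoint
  where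
  ∷-injectiveʳ : ∀ {b} {S S′ : Subset n} → b ∷ S ≡ b ∷ S′ → S ≡ S′
  ∷-injectiveʳ refl = refl
  disjoint : ∀ {S} → S ∈ˡ map (inside ∷_) (allSubsets n) × S ∈ˡ map (outside ∷_) (allSubsets n) → ⊥
  disjoint (p , q) with ∈-map⁻ (inside ∷_) p | ∈-map⁻ (outside ∷_) q
  ... | _ , _ , refl | _ , _ , ()

count-allSubsets-∷ : {P : Pred (Subset (suc n)) 0ℓ} (P? : Decidable P) →
  count P? (allSubsets (suc n)) ≡
    count (P? ∘ (inside ∷_)) (allSubsets n) + count (P? ∘ (outside ∷_)) (allSubsets n)
count-allSubsets-∷ {n} P? = begin
  count P? (map (inside ∷_) L ++ map (outside ∷_) L)
    ≡⟨ count-++ P? (map (inside ∷_) L) (map (outside ∷_) L) ⟩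
  count P? (map (inside ∷_) L) + count P? (map (outside ∷_) L)
    ≡⟨ cong₂ _+_ (count-map P? (inside ∷_) L) (count-map P? (outside ∷_) L) ⟩
  count (P? ∘ (inside ∷_)) L + count (P? ∘ (outside ∷_)) L ∎
  where
  open ≡-Reasoning
  L = allSubsets n

count-∷∷ : {P : Pred (Subset (suc (suc k))) 0ℓ} {Q : Pred (Subset k) 0ℓ} →
  (P? : Decidable P) (Q? : Decidable Q) →
  (∀ {b₀ b₁ S} → P (b₀ ∷ b₁ ∷ S) ⇔ (T (b₀ ∨ b₁) × Q S)) →
  count P? (allSubsets (suc (suc k))) ≡ 3 * count Q? (allSubsets k)
count-∷∷ {k} {P} {Q} P? Q? P⇔ = begin
  count P? (allSubsets (suc (suc k)))
    ≡⟨ count-allSubsets-∷ P? ⟩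
  count (P? ∘ (inside ∷_)) (allSubsets (suc k)) + count (P? ∘ (outside ∷_)) (allSubsets (suc k))
    ≡⟨ cong₂ _+_ (count-allSubsets-∷ (P? ∘ (inside ∷_))) (count-allSubsets-∷ (P? ∘ (outside ∷_))) ⟩
  (count (at inside inside) Sets + count (at inside outside) Sets)
    + (count (at outside inside) Sets + count (at outside outside) Sets)
    ≡⟨ cong₂ _+_ (cong₂ _+_ (count-≐ _ Q? (reduce _) Sets) (count-≐ _ Q? (reduce _) Sets))
                 (cong₂ _+_ (count-≐ _ Q? (reduce _) Sets)
                            (count-none _ (λ _ → proj₁ ∘ Equivalence.to P⇔) Sets)) ⟩
  (c + c) + (c + 0)
    ≡⟨ +-assoc c c (c + 0) ⟩
  3 * c ∎
  where
  open ≡-Reasoning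
  Sets = allSubsets k
  c = count Q? Sets
  at : ∀ b₀ b₁ → Decidable (λ S → P (b₀ ∷ b₁ ∷ S))
  at b₀ b₁ S = P? (b₀ ∷ b₁ ∷ S)
  reduce : ∀ {b₀ b₁} → T (b₀ ∨ b₁) → ∀ {S} → P (b₀ ∷ b₁ ∷ S) ⇔ Q S
  reduce b₀∨b₁ = mk⇔ (proj₂ ∘ Equivalence.to P⇔) (λ q → Equivalence.from P⇔ (b₀∨b₁ , q))

module _ {P : Pred (Fin n) 0ℓ} (P? : Decidable P) where

  fromDec : Subset n
  fromDec = tabulate (λ x → does (P? x))

  ∈-fromDec⁺ : ∀ {x} → P x → x ∈ fromDec
  ∈-fromDec⁺ {x} px = lookup⇒[]= x fromDec (trans (lookup∘tabulate _ x) (dec-true (P? x) px))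

  ∈-fromDec⁻ : ∀ {x} → x ∈ fromDec → P x
  ∈-fromDec⁻ {x} x∈ = accepted (P? x) (trans (sym (lookup∘tabulate _ x)) ([]=⇒lookup x∈))
    where
    accepted : (p? : Dec (P x)) → does p? ≡ true → P x
    accepted (yes px) _ = px

Adj-sym : (G : Graph n) {x y : Fin n} → Adj G x y → Adj G y x
Adj-sym G {x} {y} = subst T (adj-sym G x y)

AdjToAll : Graph n → Fin n → Subset n → Set
AdjToAll G x S = ∀ s → s ∈ S → s ≢ x → Adj G x s

Saturated : Graph n → Subset n → Set
Saturated G S = ∀ x → AdjToAll G x S → x ∈ S

module _ (G : Graph n) {S : Subset n} where

  maximal⇒saturated : IsMaximalClique G S → Saturated G S
  maximal⇒saturated (S-clique , S-maximal) x x-adj =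
    S-maximal (S ∪ ⁅ x ⁆) S∪x-clique (p⊆p∪q ⁅ x ⁆) (x∈p∪q⁺ (inj₂ (x∈⁅x⁆ x)))
    where
    S∪x-clique : IsClique G (S ∪ ⁅ x ⁆)
    S∪x-clique a b a∈ b∈ a≢b with x∈p∪q⁻ S ⁅ x ⁆ a∈ | x∈p∪q⁻ S ⁅ x ⁆ b∈
    ... | inj₁ a∈S | inj₁ b∈S = S-clique a b a∈S b∈S a≢b
    ... | inj₂ a∈x | inj₁ b∈S rewrite x∈⁅y⁆⇒x≡y x a∈x = x-adj b b∈S (a≢b ∘ sym)
    ... | inj₁ a∈S | inj₂ b∈x rewrite x∈⁅y⁆⇒x≡y x b∈x = Adj-sym G (x-adj a a∈S a≢b)
    ... | inj₂ a∈x | inj₂ b∈x = contradiction (trans (x∈⁅y⁆⇒x≡y x a∈x) (sym (x∈⁅y⁆⇒x≡y x b∈x))) a≢b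

  clique∧saturated⇒maximal : IsClique G S → Saturated G S → IsMaximalClique G S
  clique∧saturated⇒maximal S-clique S-saturated =
    S-clique , λ S′ S′-clique S⊆S′ {x} x∈S′ →
      S-saturated x (λ s s∈S s≢x → S′-clique x s x∈S′ (S⊆S′ s∈S) (s≢x ∘ sym))

count≤numMaxCliques : {P : Pred (Subset n) 0ℓ} (P? : Decidable P) (H : Graph k) →
  (φ : Subset n → Subset k) →
  (∀ {S} → P S → IsMaximalClique H (φ S)) → (∀ {S S′} → P S → P S′ → φ S ≡ φ S′ → S ≡ S′) →
  count P? (allSubsets n) ≤ numMaxCliques H
count≤numMaxCliques {n} {k} {P} P? H φ φ-max φ-inj =
  length-≤-injection φ (Unique.filter⁺ P? (allSubsets-unique n))
    (λ S∈ → ∈-filter⁺ (isMaximalClique? H) (allSubsets-complete _) (φ-max (selected S∈)))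
    (λ S∈ S′∈ → φ-inj (selected S∈) (selected S′∈))
  where
  selected : ∀ {S} → S ∈ˡ filter P? (allSubsets n) → P S
  selected S∈ = proj₂ (∈-filter⁻ P? {xs = allSubsets n} S∈)

record IsEdgeAddition (G K : Graph n) (u v : Fin n) : Set where
  field
    old-edge : ∀ {x y} → Adj G x y → Adj K x y
    new-edge : ∀ {x y} → Adj K x y → Adj G x y ⊎ (x ≡ u × y ≡ v) ⊎ (x ≡ v × y ≡ u)

IsEdgeAddition-swap : {G K : Graph n} {u v : Fin n} → IsEdgeAddition G K u v → IsEdgeAddition G K v u
IsEdgeAddition-swap G+uv = record
  { old-edge = old-edge
  ; new-edge = λ xy → Data.Sum.map₂ Data.Sum.swap (new-edge xy)
  }
  where open IsEdgeAddition G+uv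

+edge-isEdgeAddition : (G : Graph n) {u v : Fin n} (u≢v : u ≢ v) →
  IsEdgeAddition G (G +edge ((u , v) , u≢v)) u v
+edge-isEdgeAddition G {u} {v} u≢v = record
  { old-edge = λ {x} {y} xy → Equivalence.from (T-∨ {adj G x y}) (inj₁ xy)
  ; new-edge = λ {x} {y} xy → Data.Sum.map₂ endpoints (Equivalence.to (T-∨ {adj G x y}) xy)
  }
  where
  both : ∀ {A B : Set} (a? : Dec A) (b? : Dec B) → T (⌊ a? ⌋ ∧ ⌊ b? ⌋) → A × B
  both a? b? ab with Equivalence.to (T-∧ {⌊ a? ⌋}) ab
  ... | a , b = toWitness a , toWitness b
  endpoints : ∀ {x y} → T ((⌊ x ≟ u ⌋ ∧ ⌊ y ≟ v ⌋) ∨ (⌊ x ≟ v ⌋ ∧ ⌊ y ≟ u ⌋)) →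
    (x ≡ u × y ≡ v) ⊎ (x ≡ v × y ≡ u)
  endpoints {x} {y} e = Data.Sum.map (both (x ≟ u) (y ≟ v)) (both (x ≟ v) (y ≟ u))
    (Equivalence.to (T-∨ {⌊ x ≟ u ⌋ ∧ ⌊ y ≟ v ⌋}) e)

module CommonNeighbourhood {k} (G : Graph (suc (suc k))) {u v : Fin (suc (suc k))} (u≢v : u ≢ v) where

  ι : Fin k → Fin (suc (suc k))
  ι = punchIn u ∘ punchIn (punchOut u≢v)

  ι≢u : ∀ w → ι w ≢ u
  ι≢u w = punchInᵢ≢i u _

  ι≢v : ∀ w → ι w ≢ v
  ι≢v w ιw≡v = punchInᵢ≢i (punchOut u≢v) w
    (punchIn-injective u _ _ (trans ιw≡v (sym (punchIn-punchOut u≢v))))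

  ι-injective : ∀ {a b} → ι a ≡ ι b → a ≡ b
  ι-injective = punchIn-injective (punchOut u≢v) _ _ ∘ punchIn-injective u _ _

  data View : Fin (suc (suc k)) → Set where
    at-u : View u
    at-v : View v
    at-ι : ∀ w → View (ι w)

  view : ∀ x → View x
  view x with u ≟ x
  ... | yes refl = at-u
  ... | no u≢x with punchOut u≢v ≟ punchOut u≢x
  ... | yes eq = subst View
    (trans (sym (punchIn-punchOut u≢v)) (trans (cong (punchIn u) eq) (punchIn-punchOut u≢x))) at-v
  ... | no ne = subst View
    (trans (cong (punchIn u) (punchIn-punchOut ne)) (punchIn-punchOut u≢x)) (at-ι (punchOut ne))

  Common : Pred (Fin k) 0ℓ
  Common w = Adj G u (ι w) × Adj G v (ι w)

  common? : Decidable Common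
  common? w = T? _ ×-dec T? _

  HAdj : Fin k → Fin k → Set
  HAdj a b = a ≢ b × (Common a → Common b → Adj G (ι a) (ι b))

  HAdj? : ∀ a b → Dec (HAdj a b)
  HAdj? a b = ¬? (a ≟ b) ×-dec (common? a →-dec (common? b →-dec T? _))

  HAdj-sym : ∀ {a b} → HAdj a b → HAdj b a
  HAdj-sym (a≢b , ab) = a≢b ∘ sym , λ cb ca → Adj-sym G (ab ca cb)

  -- The common neighbourhood of u and v induced by G, padded to k vertices by universal
  -- vertices; these lie in every maximal clique, so the number of maximal cliques is kept.
  H : Graph k
  H = record { adj = λ a b → ⌊ HAdj? a b ⌋ ; adj-sym = H-sym ; adj-irr = H-irr }
    where
    H-sym : ∀ a b → ⌊ HAdj? a b ⌋ ≡ ⌊ HAdj? b a ⌋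
    H-sym a b with HAdj? a b | HAdj? b a
    ... | yes _   | yes _   = refl
    ... | no  _   | no  _   = refl
    ... | yes ab  | no  ¬ba = contradiction (HAdj-sym ab) ¬ba
    ... | no  ¬ab | yes ba  = contradiction (HAdj-sym ba) ¬ab
    H-irr : ∀ a → ⌊ HAdj? a a ⌋ ≡ false
    H-irr a with HAdj? a a
    ... | yes (a≢a , _) = contradiction refl a≢a
    ... | no  _         = refl

  kept? : ∀ S w → Dec (ι w ∈ S ⊎ ¬ Common w)
  kept? S w = ι w ∈? S ⊎-dec ¬? (common? w)

  restrict : Subset (suc (suc k)) → Subset k
  restrict S = fromDec (kept? S)

  CommonOn : Subset (suc (suc k)) → Set
  CommonOn S = ∀ w → ι w ∈ S → Common w

  ∈-restrict⁻ : ∀ {S w} → w ∈ restrict S → Common w → ι w ∈ S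
  ∈-restrict⁻ w∈ cw with ∈-fromDec⁻ (kept? _) w∈
  ... | inj₁ ιw∈S = ιw∈S
  ... | inj₂ ¬cw  = contradiction cw ¬cw

  restrict-maximal : (L : Graph (suc (suc k))) → (∀ {x y} → Adj G x y → Adj L x y) →
    (∀ {a b} → Adj L (ι a) (ι b) → Adj G (ι a) (ι b)) →
    ∀ {S} → IsMaximalClique L S → CommonOn S → IsMaximalClique H (restrict S)
  restrict-maximal L G⊆L L⊆G {S} S-max S-common = clique∧saturated⇒maximal H clique saturated
    where
    clique : IsClique H (restrict S)
    clique a b a∈ b∈ a≢b = fromWitness (a≢b , λ ca cb →
      L⊆G (proj₁ S-max (ι a) (ι b) (∈-restrict⁻ a∈ ca) (∈-restrict⁻ b∈ cb) (a≢b ∘ ι-injective)))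
    saturated : Saturated H (restrict S)
    saturated x x-adj with common? x
    ... | no ¬cx = ∈-fromDec⁺ (kept? _) (inj₂ ¬cx)
    ... | yes cx = ∈-fromDec⁺ (kept? _) (inj₁ (maximal⇒saturated L S-max (ι x) ιx-adj))
      where
      ιx-adj : AdjToAll L (ι x) S
      ιx-adj s s∈S s≢ιx with view s
      ... | at-u = G⊆L (Adj-sym G (proj₁ cx))
      ... | at-v = G⊆L (Adj-sym G (proj₂ cx))
      ... | at-ι w = G⊆L (proj₂ (toWitness (x-adj w (∈-fromDec⁺ (kept? _) (inj₁ s∈S)) (s≢ιx ∘ cong ι)))
                             cx (S-common w s∈S))

  restrict-reflects-⊆ : ∀ {S S′} → CommonOn S → (u ∈ S → u ∈ S′) → (v ∈ S → v ∈ S′) →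
    restrict S ⊆ restrict S′ → S ⊆ S′
  restrict-reflects-⊆ {S} S-common u∈ v∈ S⊆S′ {x} x∈S with view x
  ... | at-u   = u∈ x∈S
  ... | at-v   = v∈ x∈S
  ... | at-ι w = ∈-restrict⁻ (S⊆S′ (∈-fromDec⁺ (kept? _) (inj₁ x∈S))) (S-common w x∈S)

  restrict-injective : ∀ {S S′} → CommonOn S → CommonOn S′ → (u ∈ S ⇔ u ∈ S′) → (v ∈ S ⇔ v ∈ S′) →
    restrict S ≡ restrict S′ → S ≡ S′
  restrict-injective S-common S′-common u∈⇔ v∈⇔ eq = ⊆-antisym
    (restrict-reflects-⊆ S-common (Equivalence.to u∈⇔) (Equivalence.to v∈⇔) (⊆-reflexive eq))
    (restrict-reflects-⊆ S′-common (Equivalence.from u∈⇔) (Equivalence.from v∈⇔) (⊆-reflexive (sym eq)))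

module EdgeAddition {k} {G K : Graph (suc (suc k))} {u v : Fin (suc (suc k))}
  (u≢v : u ≢ v) (uv∉G : ¬ Adj G u v) (G+uv : IsEdgeAddition G K u v) where

  open IsEdgeAddition G+uv
  open CommonNeighbourhood G u≢v

  New Lost : Pred (Subset (suc (suc k))) 0ℓ
  New  S = IsMaximalClique K S × ¬ IsMaximalClique G S
  Lost S = IsMaximalClique G S × ¬ IsMaximalClique K S

  new? : Decidable New
  new? S = isMaximalClique? K S ×-dec ¬? (isMaximalClique? G S)

  lost? : Decidable Lost
  lost? S = isMaximalClique? G S ×-dec ¬? (isMaximalClique? K S)

  lost∋u? : Decidable (λ S → Lost S × u ∈ S)
  lost∋u? S = lost? S ×-dec u ∈? S

  edge-avoiding-uv : ∀ {x y} → Adj K x y → y ≢ u → y ≢ v → Adj G x y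
  edge-avoiding-uv xy y≢u y≢v with new-edge xy
  ... | inj₁ xy∈G            = xy∈G
  ... | inj₂ (inj₁ (_ , y≡v)) = contradiction y≡v y≢v
  ... | inj₂ (inj₂ (_ , y≡u)) = contradiction y≡u y≢u

  ι-edge : ∀ {x w} → Adj K x (ι w) → Adj G x (ι w)
  ι-edge {w = w} xy = edge-avoiding-uv xy (ι≢u w) (ι≢v w)

  maxK⇒maxG : ∀ {S} → IsMaximalClique K S → (u ∈ S → v ∉ S) → IsMaximalClique G S
  maxK⇒maxG {S} S-max u∈⇒v∉ = clique∧saturated⇒maximal G clique
    (λ x x-adj → maximal⇒saturated K S-max x (λ s s∈S s≢x → old-edge (x-adj s s∈S s≢x)))
    where
    clique : IsClique G S
    clique a b a∈S b∈S a≢b with new-edge (proj₁ S-max a b a∈S b∈S a≢b)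
    ... | inj₁ ab∈G                = ab∈G
    ... | inj₂ (inj₁ (refl , refl)) = contradiction b∈S (u∈⇒v∉ a∈S)
    ... | inj₂ (inj₂ (refl , refl)) = contradiction a∈S (u∈⇒v∉ b∈S)

  maxG⇒maxK : ∀ {S} → IsMaximalClique G S → v ∉ S → ¬ AdjToAll K v S → IsMaximalClique K S
  maxG⇒maxK {S} S-max v∉S ¬v-adj = clique∧saturated⇒maximal K
    (λ a b a∈S b∈S a≢b → old-edge (proj₁ S-max a b a∈S b∈S a≢b)) saturated
    where
    saturated : Saturated K S
    saturated x x-adj with x ≟ v
    ... | yes refl = contradiction x-adj ¬v-adj
    ... | no x≢v = maximal⇒saturated G S-max x x-adj′
      where
      x-adj′ : AdjToAll G x S
      x-adj′ s s∈S s≢x with new-edge (x-adj s s∈S s≢x)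
      ... | inj₁ xs∈G            = xs∈G
      ... | inj₂ (inj₁ (_ , refl)) = contradiction s∈S v∉S
      ... | inj₂ (inj₂ (x≡v , _)) = contradiction x≡v x≢v

  new⇒ends : ∀ {S} → New S → u ∈ S × v ∈ S
  new⇒ends {S} (S-maxK , ¬S-maxG) with u ∈? S | v ∈? S
  ... | yes u∈S | yes v∈S = u∈S , v∈S
  ... | no  u∉S | _       = contradiction (maxK⇒maxG S-maxK (λ u∈S → contradiction u∈S u∉S)) ¬S-maxG
  ... | yes _   | no  v∉S = contradiction (maxK⇒maxG S-maxK (λ _ → v∉S)) ¬S-maxG

  new⇒commonOn : ∀ {S} → New S → CommonOn S
  new⇒commonOn S-new@(S-maxK , _) w ιw∈S =
    ι-edge (proj₁ S-maxK u (ι w) u∈S ιw∈S (ι≢u w ∘ sym)) ,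
    ι-edge (proj₁ S-maxK v (ι w) v∈S ιw∈S (ι≢v w ∘ sym))
    where
    u∈S = proj₁ (new⇒ends S-new)
    v∈S = proj₂ (new⇒ends S-new)

  lost⇒ends : ∀ {S} → Lost S → u ∈ S ⊎ v ∈ S
  lost⇒ends {S} (S-maxG , ¬S-maxK) with u ∈? S | v ∈? S
  ... | yes u∈S | _       = inj₁ u∈S
  ... | no  _   | yes v∈S = inj₂ v∈S
  ... | no  u∉S | no  v∉S = contradiction (maxG⇒maxK S-maxG v∉S ¬v-adj) ¬S-maxK
    where
    ¬v-adj : ¬ AdjToAll K v S
    ¬v-adj v-adj = v∉S (maximal⇒saturated G S-maxG v λ s s∈S s≢v →
      edge-avoiding-uv (v-adj s s∈S s≢v) (λ { refl → u∉S s∈S }) s≢v)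

  lost∋u⇒v∉ : ∀ {S} → Lost S → u ∈ S → v ∉ S
  lost∋u⇒v∉ (S-maxG , _) u∈S v∈S = uv∉G (proj₁ S-maxG u v u∈S v∈S u≢v)

  lost∋u⇒commonOn : ∀ {S} → Lost S → u ∈ S → CommonOn S
  lost∋u⇒commonOn {S} S-lost@(S-maxG , ¬S-maxK) u∈S w ιw∈S with T? (adj G v (ι w))
  ... | yes vw∈G = proj₁ S-maxG u (ι w) u∈S ιw∈S (ι≢u w ∘ sym) , vw∈G
  ... | no  vw∉G = contradiction (maxG⇒maxK S-maxG (lost∋u⇒v∉ S-lost u∈S) ¬v-adj) ¬S-maxK
    where
    ¬v-adj : ¬ AdjToAll K v S
    ¬v-adj v-adj = vw∉G (ι-edge (v-adj (ι w) ιw∈S (ι≢v w)))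

  count-new≤ : count new? (allSubsets (suc (suc k))) ≤ numMaxCliques H
  count-new≤ = count≤numMaxCliques new? H restrict
    (λ S-new → restrict-maximal K old-edge ι-edge (proj₁ S-new) (new⇒commonOn S-new))
    (λ S-new S′-new → restrict-injective (new⇒commonOn S-new) (new⇒commonOn S′-new)
      (mk⇔ (λ _ → proj₁ (new⇒ends S′-new)) (λ _ → proj₁ (new⇒ends S-new)))
      (mk⇔ (λ _ → proj₂ (new⇒ends S′-new)) (λ _ → proj₂ (new⇒ends S-new))))

  count-lost∋u≤ : count lost∋u? (allSubsets (suc (suc k))) ≤ numMaxCliques H
  count-lost∋u≤ = count≤numMaxCliques lost∋u? H restrict
    (λ (S-lost , u∈S) → restrict-maximal G id id (proj₁ S-lost) (lost∋u⇒commonOn S-lost u∈S))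
    (λ (S-lost , u∈S) (S′-lost , u∈S′) → restrict-injective
      (lost∋u⇒commonOn S-lost u∈S) (lost∋u⇒commonOn S′-lost u∈S′)
      (mk⇔ (λ _ → u∈S′) (λ _ → u∈S))
      (mk⇔ (λ v∈S → contradiction v∈S (lost∋u⇒v∉ S-lost u∈S))
           (λ v∈S′ → contradiction v∈S′ (lost∋u⇒v∉ S′-lost u∈S′))))

cardΛ-edgeAddition≤ : ∀ {k m} → (∀ (H : Graph k) → numMaxCliques H ≤ m) →
  {G K : Graph (suc (suc k))} {u v : Fin (suc (suc k))} →
  u ≢ v → ¬ Adj G u v → IsEdgeAddition G K u v → cardΛ G K ≤ 3 * m
cardΛ-edgeAddition≤ {k} {m} bound {G} {K} {u} {v} u≢v uv∉G G+uv = begin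
  cardΛ G K
    ≤⟨ count-⊎ new? lost? Sets ⟩
  count new? Sets + count lost? Sets
    ≤⟨ +-monoʳ-≤ (count new? Sets)
         (≤-trans (count-mono lost? lost∋u⊎v? lost-split Sets) (count-⊎ lost∋u? V.lost∋u? Sets)) ⟩
  count new? Sets + (count lost∋u? Sets + count V.lost∋u? Sets)
    ≤⟨ +-mono-≤ (≤-trans count-new≤ (bound _))
                (+-mono-≤ (≤-trans count-lost∋u≤ (bound _)) (≤-trans V.count-lost∋u≤ (bound _))) ⟩
  m + (m + m)
    ≡⟨ cong (λ z → m + (m + z)) (sym (+-identityʳ m)) ⟩
  3 * m ∎
  where
  open ≤-Reasoning
  open EdgeAddition u≢v uv∉G G+uv
  module V = EdgeAddition (u≢v ∘ sym) (uv∉G ∘ Adj-sym G) (IsEdgeAddition-swap G+uv)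
  Sets = allSubsets (suc (suc k))
  lost∋u⊎v? : Decidable (λ S → (Lost S × u ∈ S) ⊎ (Lost S × v ∈ S))
  lost∋u⊎v? S = lost∋u? S ⊎-dec V.lost∋u? S
  lost-split : ∀ {S} → Lost S → (Lost S × u ∈ S) ⊎ (Lost S × v ∈ S)
  lost-split S-lost = Data.Sum.map (S-lost ,_) (S-lost ,_) (lost⇒ends S-lost)

module TwoApices {k} (H : Graph k) where

  pattern apex₀ = zero
  pattern apex₁ = suc zero
  pattern base w = suc (suc w)

  record IsApexExtension (L : Graph (suc (suc k))) : Set where
    field
      base⇒ : ∀ {a b} → Adj L (base a) (base b) → Adj H a b
      base⇐ : ∀ {a b} → Adj H a b → Adj L (base a) (base b)
      apex₀-adj : ∀ {w} → Adj L apex₀ (base w)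
      apex₁-adj : ∀ {w} → Adj L apex₁ (base w)

  -- MaximalApexPair a b₀ b₁: the apices selected by b₀, b₁ form a maximal clique of the
  -- two-vertex graph whose edge is present iff a.
  data MaximalApexPair : Bool → Bool → Bool → Set where
    both   : MaximalApexPair true  inside  inside
    first  : MaximalApexPair false inside  outside
    second : MaximalApexPair false outside inside

  base-injective : ∀ {a b : Fin k} → _≡_ {A = Fin (suc (suc k))} (base a) (base b) → a ≡ b
  base-injective refl = refl

  base-cong : ∀ {a b : Fin k} → a ≡ b → _≡_ {A = Fin (suc (suc k))} (base a) (base b)
  base-cong refl = refl

  module _ {L : Graph (suc (suc k))} (L-ext : IsApexExtension L) where

    open IsApexExtension L-ext

    apex₀-adjToAll : ∀ {b₀ b₁ S} → (b₁ ≡ inside → Adj L apex₀ apex₁) → AdjToAll L apex₀ (b₀ ∷ b₁ ∷ S)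
    apex₀-adjToAll _  apex₀    _            0≢0 = contradiction refl 0≢0
    apex₀-adjToAll adj₀₁ apex₁ (there here) _   = adj₀₁ refl
    apex₀-adjToAll _  (base w) _            _   = apex₀-adj

    apex₁-adjToAll : ∀ {b₀ b₁ S} → (b₀ ≡ inside → Adj L apex₁ apex₀) → AdjToAll L apex₁ (b₀ ∷ b₁ ∷ S)
    apex₁-adjToAll adj₁₀ apex₀ here _   = adj₁₀ refl
    apex₁-adjToAll _  apex₁    _    1≢1 = contradiction refl 1≢1
    apex₁-adjToAll _  (base w) _    _   = apex₁-adj

    base-adjToAll⁺ : ∀ {b₀ b₁ S w} → AdjToAll H w S → AdjToAll L (base w) (b₀ ∷ b₁ ∷ S)
    base-adjToAll⁺ w-adj apex₀    _                  _   = Adj-sym L apex₀-adj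
    base-adjToAll⁺ w-adj apex₁    _                  _   = Adj-sym L apex₁-adj
    base-adjToAll⁺ w-adj (base s) (there (there s∈S)) s≢w = base⇐ (w-adj s s∈S (s≢w ∘ base-cong))

    base-adjToAll⁻ : ∀ {b₀ b₁ S w} → AdjToAll L (base w) (b₀ ∷ b₁ ∷ S) → AdjToAll H w S
    base-adjToAll⁻ w-adj s s∈S s≢w = base⇒ (w-adj (base s) (there (there s∈S)) (s≢w ∘ base-injective))

    base-maximal : ∀ {b₀ b₁ S} → IsMaximalClique L (b₀ ∷ b₁ ∷ S) → IsMaximalClique H S
    base-maximal {b₀} {b₁} {S} S′-max = clique∧saturated⇒maximal H clique saturated
      where
      clique : IsClique H S
      clique a b a∈S b∈S a≢b =
        base⇒ (proj₁ S′-max (base a) (base b) (there (there a∈S)) (there (there b∈S)) (a≢b ∘ base-injective))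
      saturated : Saturated H S
      saturated x x-adj with maximal⇒saturated L S′-max (base x) (base-adjToAll⁺ x-adj)
      ... | there (there x∈S) = x∈S

    apex-pair : ∀ {b₀ b₁ S} → IsMaximalClique L (b₀ ∷ b₁ ∷ S) → MaximalApexPair (adj L apex₀ apex₁) b₀ b₁
    apex-pair {inside} {inside} S′-max
      with adj L apex₀ apex₁ | proj₁ S′-max apex₀ apex₁ here (there here) (λ ())
    ... | true | _ = both
    apex-pair {inside} {outside} S′-max with adj L apex₀ apex₁ in adj₀₁
    ... | false = first
    ... | true
      with maximal⇒saturated L S′-max apex₁ (apex₁-adjToAll (λ _ → Adj-sym L (subst T (sym adj₀₁) _)))
    ... | there ()
    apex-pair {outside} {inside} S′-max with adj L apex₀ apex₁ in adj₀₁
    ... | false = second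
    ... | true with maximal⇒saturated L S′-max apex₀ (apex₀-adjToAll (λ _ → subst T (sym adj₀₁) _))
    ... | ()
    apex-pair {outside} {outside} S′-max with maximal⇒saturated L S′-max apex₀ (apex₀-adjToAll λ ())
    ... | ()

    pair-adjacent : ∀ {b₀ b₁} → MaximalApexPair (adj L apex₀ apex₁) b₀ b₁ →
      b₀ ≡ inside → b₁ ≡ inside → Adj L apex₀ apex₁
    pair-adjacent pair refl refl with adj L apex₀ apex₁ | pair
    ... | true | both = _

    pair-saturated₀ : ∀ {b₀ b₁} → MaximalApexPair (adj L apex₀ apex₁) b₀ b₁ →
      (b₁ ≡ inside → Adj L apex₀ apex₁) → b₀ ≡ inside
    pair-saturated₀ pair adj₀₁ with adj L apex₀ apex₁ | pair
    ... | true  | both   = refl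
    ... | false | first  = refl
    ... | false | second = ⊥-elim (adj₀₁ refl)

    pair-saturated₁ : ∀ {b₀ b₁} → MaximalApexPair (adj L apex₀ apex₁) b₀ b₁ →
      (b₀ ≡ inside → Adj L apex₀ apex₁) → b₁ ≡ inside
    pair-saturated₁ pair adj₀₁ with adj L apex₀ apex₁ | pair
    ... | true  | both   = refl
    ... | false | first  = ⊥-elim (adj₀₁ refl)
    ... | false | second = refl

    extend-clique : ∀ {b₀ b₁ S} → (b₀ ≡ inside → b₁ ≡ inside → Adj L apex₀ apex₁) →
      IsClique H S → IsClique L (b₀ ∷ b₁ ∷ S)
    extend-clique adj₀₁ S-clique apex₀ apex₁ here (there here) _ = adj₀₁ refl refl
    extend-clique adj₀₁ S-clique apex₁ apex₀ (there here) here _ = Adj-sym L (adj₀₁ refl refl)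
    extend-clique adj₀₁ S-clique apex₀ (base b) _ _ _ = apex₀-adj
    extend-clique adj₀₁ S-clique apex₁ (base b) _ _ _ = apex₁-adj
    extend-clique adj₀₁ S-clique (base a) apex₀ _ _ _ = Adj-sym L apex₀-adj
    extend-clique adj₀₁ S-clique (base a) apex₁ _ _ _ = Adj-sym L apex₁-adj
    extend-clique adj₀₁ S-clique (base a) (base b) (there (there a∈S)) (there (there b∈S)) a≢b =
      base⇐ (S-clique a b a∈S b∈S (a≢b ∘ base-cong))
    extend-clique adj₀₁ S-clique apex₀ apex₀ _ _ 0≢0 = contradiction refl 0≢0
    extend-clique adj₀₁ S-clique apex₁ apex₁ _ _ 1≢1 = contradiction refl 1≢1

    extend-maximal : ∀ {b₀ b₁ S} → MaximalApexPair (adj L apex₀ apex₁) b₀ b₁ → IsMaximalClique H S →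
      IsMaximalClique L (b₀ ∷ b₁ ∷ S)
    extend-maximal {b₀} {b₁} {S} pair S-max =
      clique∧saturated⇒maximal L (extend-clique (pair-adjacent pair) (proj₁ S-max)) saturated
      where
      apex₀-∈ : b₀ ≡ inside → apex₀ ∈ (b₀ ∷ b₁ ∷ S)
      apex₀-∈ refl = here
      apex₁-∈ : b₁ ≡ inside → apex₁ ∈ (b₀ ∷ b₁ ∷ S)
      apex₁-∈ refl = there here
      saturated : Saturated L (b₀ ∷ b₁ ∷ S)
      saturated apex₀ x-adj = apex₀-∈ (pair-saturated₀ pair λ b₁≡inside →
        x-adj apex₁ (apex₁-∈ b₁≡inside) (λ ()))
      saturated apex₁ x-adj = apex₁-∈ (pair-saturated₁ pair λ b₀≡inside →
        Adj-sym L (x-adj apex₀ (apex₀-∈ b₀≡inside) (λ ())))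
      saturated (base w) x-adj = there (there (maximal⇒saturated H S-max w (base-adjToAll⁻ x-adj)))

    maximal-∷∷ : ∀ {a b₀ b₁ S} → adj L apex₀ apex₁ ≡ a →
      IsMaximalClique L (b₀ ∷ b₁ ∷ S) ⇔ (MaximalApexPair a b₀ b₁ × IsMaximalClique H S)
    maximal-∷∷ refl = mk⇔ (λ S′-max → apex-pair S′-max , base-maximal S′-max)
                          (λ (pair , S-max) → extend-maximal pair S-max)

  apexAdj : Fin (suc (suc k)) → Fin (suc (suc k)) → Bool
  apexAdj (base a) (base b) = adj H a b
  apexAdj apex₀    apex₁    = false
  apexAdj apex₁    apex₀    = false
  apexAdj apex₀    apex₀    = false
  apexAdj apex₁    apex₁    = false
  apexAdj _        _        = true

  G₀ : Graph (suc (suc k))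
  G₀ = record { adj = apexAdj ; adj-sym = sym′ ; adj-irr = irr }
    where
    sym′ : ∀ x y → apexAdj x y ≡ apexAdj y x
    sym′ (base a) (base b) = adj-sym H a b
    sym′ apex₀    apex₀    = refl
    sym′ apex₀    apex₁    = refl
    sym′ apex₀    (base _) = refl
    sym′ apex₁    apex₀    = refl
    sym′ apex₁    apex₁    = refl
    sym′ apex₁    (base _) = refl
    sym′ (base _) apex₀    = refl
    sym′ (base _) apex₁    = refl
    irr : ∀ x → apexAdj x x ≡ false
    irr apex₀    = refl
    irr apex₁    = refl
    irr (base a) = adj-irr H a

  apex₀≢apex₁ : _≢_ {A = Fin (suc (suc k))} apex₀ apex₁
  apex₀≢apex₁ ()

  G₀-isApexExtension : IsApexExtension G₀
  G₀-isApexExtension = record { base⇒ = id ; base⇐ = id ; apex₀-adj = _ ; apex₁-adj = _ }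

  +edge-isApexExtension : IsApexExtension (G₀ +edge ((apex₀ , apex₁) , apex₀≢apex₁))
  +edge-isApexExtension = record
    { base⇒ = base⇒ ; base⇐ = old-edge
    ; apex₀-adj = λ {w} → old-edge {apex₀} {base w} _ ; apex₁-adj = λ {w} → old-edge {apex₁} {base w} _ }
    where
    open IsEdgeAddition (+edge-isEdgeAddition G₀ apex₀≢apex₁)
    base⇒ : ∀ {a b} → Adj (G₀ +edge ((apex₀ , apex₁) , apex₀≢apex₁)) (base a) (base b) → Adj H a b
    base⇒ ab with new-edge ab
    ... | inj₁ ab∈G₀ = ab∈G₀
    ... | inj₂ (inj₁ (() , _))
    ... | inj₂ (inj₂ (() , _))

  module _ {G K : Graph (suc (suc k))} (G-ext : IsApexExtension G) (K-ext : IsApexExtension K)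
    (apices∉G : adj G apex₀ apex₁ ≡ false) (apices∈K : adj K apex₀ apex₁ ≡ true) where

    private
      maxG⇔ : ∀ {b₀ b₁ S} →
        IsMaximalClique G (b₀ ∷ b₁ ∷ S) ⇔ (MaximalApexPair false b₀ b₁ × IsMaximalClique H S)
      maxG⇔ = maximal-∷∷ G-ext apices∉G
      maxK⇔ : ∀ {b₀ b₁ S} →
        IsMaximalClique K (b₀ ∷ b₁ ∷ S) ⇔ (MaximalApexPair true b₀ b₁ × IsMaximalClique H S)
      maxK⇔ = maximal-∷∷ K-ext apices∈K

    Λ-∷∷ : ∀ {b₀ b₁ S} → InΛ G K (b₀ ∷ b₁ ∷ S) ⇔ (T (b₀ ∨ b₁) × IsMaximalClique H S)
    Λ-∷∷ = mk⇔ to from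
      where
      to : ∀ {b₀ b₁ S} → InΛ G K (b₀ ∷ b₁ ∷ S) → T (b₀ ∨ b₁) × IsMaximalClique H S
      to (inj₁ (S′-maxK , _)) with Equivalence.to maxK⇔ S′-maxK
      ... | both , S-max = _ , S-max
      to (inj₂ (S′-maxG , _)) with Equivalence.to maxG⇔ S′-maxG
      ... | first  , S-max = _ , S-max
      ... | second , S-max = _ , S-max
      from : ∀ {b₀ b₁ S} → T (b₀ ∨ b₁) × IsMaximalClique H S → InΛ G K (b₀ ∷ b₁ ∷ S)
      from {inside} {inside} (_ , S-max) = inj₁ (Equivalence.from maxK⇔ (both , S-max) ,
        λ S′-maxG → case proj₁ (Equivalence.to maxG⇔ S′-maxG) of λ ())
      from {inside} {outside} (_ , S-max) = inj₂ (Equivalence.from maxG⇔ (first , S-max) ,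
        λ S′-maxK → case proj₁ (Equivalence.to maxK⇔ S′-maxK) of λ ())
      from {outside} {inside} (_ , S-max) = inj₂ (Equivalence.from maxG⇔ (second , S-max) ,
        λ S′-maxK → case proj₁ (Equivalence.to maxK⇔ S′-maxK) of λ ())

    cardΛ-apices : cardΛ G K ≡ 3 * numMaxCliques H
    cardΛ-apices = count-∷∷ (λ S → (isMaximalClique? K S ×-dec ¬? (isMaximalClique? G S))
      ⊎-dec (isMaximalClique? G S ×-dec ¬? (isMaximalClique? K S))) (isMaximalClique? H) Λ-∷∷

  apices-joined : ∀ {m} → numMaxCliques H ≡ m →
    Σ (Graph (suc (suc k))) λ G → Σ (Fin (suc (suc k))) λ u → Σ (Fin (suc (suc k))) λ v →
    Σ (u ≢ v) λ u≢v → (¬ Adj G u v) × (cardΛ G (G +edge ((u , v) , u≢v)) ≡ 3 * m)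
  -- The graphs are given explicitly here and in cardΛ-+edge≤: left to unification, they
  -- would be found by unfolding cardΛ, which is prohibitively slow.
  apices-joined H-count = G₀ , apex₀ , apex₁ , apex₀≢apex₁ , (λ ()) , trans
    (cardΛ-apices {G₀} {G₀ +edge ((apex₀ , apex₁) , apex₀≢apex₁)}
      G₀-isApexExtension +edge-isApexExtension refl refl)
    (cong (3 *_) H-count)

cardΛ-+edge≤ : ∀ {k m} → (∀ (H : Graph k) → numMaxCliques H ≤ m) →
  (G : Graph (suc (suc k))) (u v : Fin (suc (suc k))) (u≢v : u ≢ v) → ¬ Adj G u v →
  cardΛ G (G +edge ((u , v) , u≢v)) ≤ 3 * m
cardΛ-+edge≤ {k} {m} bound G u v u≢v uv∉G =
  cardΛ-edgeAddition≤ bound {G} {G +edge ((u , v) , u≢v)} u≢v uv∉G (+edge-isEdgeAddition G u≢v)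

lemma1 : (n : ℕ) → 2 < n → (m : ℕ) → IsF (n ∸ 2) m →
    ((G : Graph n) (u v : Fin n) (u≢v : u ≢ v) → ¬ Adj G u v →
       cardΛ G (G +edge ((u , v) , u≢v)) ≤ 3 * m)
    × (Σ (Graph n) λ G → Σ (Fin n) λ u → Σ (Fin n) λ v → Σ (u ≢ v) λ u≢v →
       (¬ Adj G u v) × (cardΛ G (G +edge ((u , v) , u≢v)) ≡ 3 * m))
lemma1 zero () _ _
lemma1 (suc zero) (s≤s ()) _ _
-- k is passed explicitly: inferred from the type of H it would be 2 + k ∸ 2.
lemma1 (suc (suc k)) _ m ((H , H-count) , bound) =
  cardΛ-+edge≤ {k} bound , TwoApices.apices-joined {k} H H-count
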